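{- Let $n$ and $p$ be integers with $2 \leq p \leq \frac{n-1}{2}$. Let $G_{n,p}$ be the graph constructed as follows: take a path $a_0, a_1, \ldots, a_{p-1}$; for each $0 \leq i < p-1$ add a new vertex $b_i$ adjacent to $a_i$ and $a_{i+1}$ (so $a_i, b_i, a_{i+1}$ form a triangle); finally take a cycle of length $n - 2(p-1)$ and identify one of its vertices with $a_{p-1}$. (Thus $G_{n,p}$ has $n$ vertices and $p$ blocks.) Then \[\overrightarrow{\mathrm{diam}}(G_{n,p}) = n - \left\lfloor \frac{p}{2} \right\rfloor.\]
   Context: An orientation of a graph assigns a direction to each edge; it is strong if the resulting digraph is strongly connected. The diameter of a strong digraph is the maximum over ordered pairs $(u,v)$ of the directed distance from $u$ to $v$. The oriented diameter $\overrightarrow{\mathrm{diam}}(G)$ of a bridgeless graph $G$ is the minimum diameter over all strong orientations of $G$. -}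

module Defs where

open import Data.Nat using (ℕ; zero; suc; _+_; _*_; _∸_; _≤_; _<_)
open import Data.Fin using (Fin; toℕ)
open import Data.Product using (Σ; _×_; ∃)
open import Data.Sum using (_⊎_)
open import Data.Empty using (⊥)

Graph : ℕ → Set₁
Graph n = Fin n → Fin n → Set

Digraph : ℕ → Set₁
Digraph n = Fin n → Fin n → Set

IsOrientation : ∀ {n} → Graph n → Digraph n → Set
IsOrientation {n} G A =
  (∀ (u v : Fin n) → A u v → G u v) ×
  (∀ (u v : Fin n) → G u v → A u v ⊎ A v u) ×
  (∀ (u v : Fin n) → A u v → A v u → ⊥)

data Walk {n : ℕ} (A : Digraph n) : Fin n → Fin n → ℕ → Set where
  here : ∀ {u} → Walk A u u zero
  step : ∀ {u w v k} → A u w → Walk A w v k → Walk A u v (suc k)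

DistAtMost : ∀ {n} → Digraph n → Fin n → Fin n → ℕ → Set
DistAtMost A u v d = Σ ℕ (λ k → k ≤ d × Walk A u v k)

Strong : ∀ {n} → Digraph n → Set
Strong {n} A = ∀ (u v : Fin n) → Σ ℕ (λ k → Walk A u v k)

DiamAtMost : ∀ {n} → Digraph n → ℕ → Set
DiamAtMost {n} A d = ∀ (u v : Fin n) → DistAtMost A u v d

OrientedDiameter : ∀ {n} → Graph n → ℕ → Set₁
OrientedDiameter {n} G m =
  Σ (Digraph n) (λ A → IsOrientation G A × Strong A × DiamAtMost A m) ×
  (∀ (A : Digraph n) (d : ℕ) → IsOrientation G A → Strong A →
     DiamAtMost A d → m ≤ d)

-- Vertex numbering (as natural numbers < n):
--   a_i       ↦ i            (0 ≤ i ≤ p-1)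
--   b_i       ↦ p + i        (0 ≤ i < p-1)
--   c_j       ↦ 2p-2+j       (1 ≤ j ≤ L-1, L = n - 2(p-1))
-- where the cycle is a_{p-1}, c_1, ..., c_{L-1}, a_{p-1}.

data GEdge (n p : ℕ) : ℕ → ℕ → Set where
  path  : ∀ i → suc i < p → GEdge n p i (suc i)
  triL  : ∀ i → suc i < p → GEdge n p (p + i) i
  triR  : ∀ i → suc i < p → GEdge n p (p + i) (suc i)
  cyc   : ∀ x → 2 * p ∸ 1 ≤ x → suc x < n → GEdge n p x (suc x)
  close₁ : GEdge n p (p ∸ 1) (2 * p ∸ 1)
  close₂ : GEdge n p (p ∸ 1) (n ∸ 1)

Gnp : (n p : ℕ) → Graph n
Gnp n p u v = GEdge n p (toℕ u) (toℕ v) ⊎ GEdge n p (toℕ v) (toℕ u)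

-- In a strong orientation a vertex whose only neighbours are a and b
-- turns an arc a → x into an arc x → b, so the long cycle is a directed cycle.
-- Charge a path edge a_i a_{i+1} one if it points forward and two otherwise (the
-- detour through b_i).  A potential that rises by at most one along every arc shows
-- that the walk from the start of the chain of triangles (b₀ if a₁ → b₀, else a₀) to
-- the far end of the cycle is at least the total charge, plus one if it starts at b₀,
-- plus n − 2p + 1.  For the reversed orientation both the charges and the choice of
-- start are complementary, so twice the diameter is at least
-- 3(p − 1) + 1 + 2(n − 2p + 1) = 2n − p.
--
-- Orient the path edges alternately, every triangle as a directed
-- triangle, and the long cycle as a directed cycle.  The path then costs
-- (p − 1) + ⌊(p − 1)/2⌋ forwards and 2(p − 1) − ⌊(p − 1)/2⌋ backwards, and routing
-- every walk along the path or through a_{p−1} keeps it within n − ⌊p/2⌋.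

module Submission where

open import Defs
open import Data.Nat
open import Data.Nat.Properties
open import Data.Nat.DivMod using (m%n<n; m≡m%n+[m/n]*n; m/n≡1+[m∸n]/n)
open import Data.Nat.Tactic.RingSolver using (solve-∀)
open import Data.Bool using (Bool; true; false; not)
open import Data.Fin using (Fin; toℕ; fromℕ<)
open import Data.Fin.Properties using (toℕ-fromℕ<; toℕ-injective; toℕ<n)
open import Data.Product using (Σ; ∃; ∃₂; _×_; _,_; proj₁; proj₂)
open import Data.Sum using (_⊎_; inj₁; inj₂; swap; [_,_]′) renaming (map to ⊎-map)
open import Data.Empty using (⊥; ⊥-elim)
open import Function using (_∘_; flip)
open import Relation.Nullary using (¬_; yes; no)
open import Relation.Binary.Definitions using (tri<; tri≈; tri>)
open import Relation.Binary.PropositionalEquality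

walk-snoc : ∀ {n} {A : Digraph n} {u w v k} → Walk A u w k → A w v → Walk A u v (suc k)
walk-snoc here        a = step a here
walk-snoc (step b ws) a = step b (walk-snoc ws a)

module _ {n : ℕ} {A : Digraph n} where

  walk-reverse : ∀ {u v k} → Walk A u v k → Walk (flip A) v u k
  walk-reverse here        = here
  walk-reverse (step a ws) = walk-snoc (walk-reverse ws) a

  walk-head : ∀ {u v k} → Walk A u v k → u ≢ v → ∃ (A u)
  walk-head here       u≢u = ⊥-elim (u≢u refl)
  walk-head (step a _) _   = _ , a

  walk-potential : (f : Fin n → ℕ) → (∀ {w w′} → A w w′ → f w′ ≤ suc (f w)) →
                   ∀ {u v k} → Walk A u v k → f v ≤ f u + k
  walk-potential f f-step {u} here = ≤-reflexive (sym (+-identityʳ (f u)))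
  walk-potential f f-step {u} {v} (step {w = w} {k = k} a ws) = begin
    f v           ≤⟨ walk-potential f f-step ws ⟩
    f w + k       ≤⟨ +-monoˡ-≤ k (f-step a) ⟩
    suc (f u) + k ≡⟨ sym (+-suc (f u) k) ⟩
    f u + suc k   ∎
    where open ≤-Reasoning

  diameter⇒strong : ∀ {d} → DiamAtMost A d → Strong A
  diameter⇒strong diam u v = let (k , _ , ws) = diam u v in k , ws

  flip-strong : Strong A → Strong (flip A)
  flip-strong strong u v = let (k , ws) = strong v u in k , walk-reverse ws

  flip-diameter : ∀ {d} → DiamAtMost A d → DiamAtMost (flip A) d
  flip-diameter diam u v = let (k , k≤d , ws) = diam v u in k , k≤d , walk-reverse ws

  flip-orientation : {G : Graph n} → (∀ {u v} → G u v → G v u) →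
                     IsOrientation G A → IsOrientation G (flip A)
  flip-orientation G-sym (A⊆G , total , asym) =
    (λ u v a → G-sym (A⊆G v u a)) ,
    (λ u v uv → swap (total u v uv)) ,
    (λ u v a b → asym v u a b)

OneOf₃ : ℕ → ℕ → ℕ → ℕ → Set
OneOf₃ x y z u = u ≡ x ⊎ u ≡ y ⊎ u ≡ z

module _ (R : ℕ → ℕ → Set) where

  infixr 5 _∷_

  data Chain : ℕ → ℕ → ℕ → Set where
    [] : ∀ {x} → Chain x x 0
    _∷_ : ∀ {x y z k} → R x y → Chain y z k → Chain x z (suc k)

  Within : ℕ → ℕ → ℕ → Set
  Within x y d = Σ ℕ λ k → k ≤ d × Chain x y k

module _ {R : ℕ → ℕ → Set} where

  infixr 5 _++_
  infixr 4 _⊕_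

  _++_ : ∀ {x y z k l} → Chain R x y k → Chain R y z l → Chain R x z (k + l)
  []       ++ ys = ys
  (a ∷ xs) ++ ys = a ∷ (xs ++ ys)

  _⊕_ : ∀ {x y z d e} → Within R x y d → Within R y z e → Within R x z (d + e)
  (k , k≤d , xs) ⊕ (l , l≤e , ys) = k + l , +-mono-≤ k≤d l≤e , xs ++ ys

  within-weaken : ∀ {x y d e} → d ≤ e → Within R x y d → Within R x y e
  within-weaken d≤e (k , k≤d , xs) = k , ≤-trans k≤d d≤e , xs

  chain⇒walk : ∀ {n} → (∀ {x y} → R x y → y < n) →
               ∀ {x y k} → Chain R x y k → (u v : Fin n) → toℕ u ≡ x → toℕ v ≡ y →
               Walk (λ u v → R (toℕ u) (toℕ v)) u v k
  chain⇒walk bounded []       u v refl v≡u with toℕ-injective v≡u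
  ... | refl = here
  chain⇒walk bounded (a ∷ xs) u v refl v≡z =
    step (subst (R _) (sym (toℕ-fromℕ< (bounded a))) a)
         (chain⇒walk bounded xs (fromℕ< (bounded a)) v (toℕ-fromℕ< (bounded a)) v≡z)

  module DirectedCycle (v : ℕ → ℕ) (ℓ : ℕ)
    (forward : ∀ j → j < ℓ → R (v j) (v (suc j))) (closing : R (v ℓ) (v 0)) where

    climb : ∀ m i → m + i ≤ ℓ → Chain R (v i) (v (m + i)) m
    climb zero    i _         = []
    climb (suc m) i 1+m+i≤ℓ =
      forward i (≤-<-trans (m≤n+m i m) 1+m+i≤ℓ) ∷
      subst (λ k → Chain R (v (suc i)) (v k) m) (+-suc m i)
            (climb m (suc i) (≤-trans (≤-reflexive (+-suc m i)) 1+m+i≤ℓ))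

    climb-to : ∀ {i j} → i ≤ j → j ≤ ℓ → Chain R (v i) (v j) (j ∸ i)
    climb-to {i} {j} i≤j j≤ℓ =
      subst (λ k → Chain R (v i) (v k) (j ∸ i)) (m∸n+n≡m i≤j)
            (climb (j ∸ i) i (≤-trans (≤-reflexive (m∸n+n≡m i≤j)) j≤ℓ))

    within : ∀ {i j} → i ≤ ℓ → j ≤ ℓ → Within R (v i) (v j) ℓ
    within {i} {j} i≤ℓ j≤ℓ with i ≤? j
    ... | yes i≤j = j ∸ i , ≤-trans (m∸n≤m j i) j≤ℓ , climb-to i≤j j≤ℓ
    ... | no  i≰j = (ℓ ∸ i) + suc j , bound , climb-to i≤ℓ ≤-refl ++ (closing ∷ climb-to z≤n j≤ℓ)
      where
      bound : (ℓ ∸ i) + suc j ≤ ℓ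
      bound = ≤-trans (+-monoʳ-≤ (ℓ ∸ i) (≰⇒> i≰j)) (≤-reflexive (m∸n+n≡m i≤ℓ))

  directed-triangle-within : ∀ {x y z} → R x y → R y z → R z x →
                    ∀ {u w} → OneOf₃ x y z u → OneOf₃ x y z w → Within R u w 2
  directed-triangle-within {x} {y} {z} xy yz zx u∈ w∈ =
    let (i , i≤2 , vi≡u) = corner u∈
        (j , j≤2 , vj≡w) = corner w∈
    in subst₂ (λ u w → Within R u w 2) vi≡u vj≡w (DirectedCycle.within v 2 forward zx i≤2 j≤2)
    where
    v : ℕ → ℕ
    v 0 = x
    v 1 = y
    v _ = z
    forward : ∀ j → j < 2 → R (v j) (v (suc j))
    forward 0 _ = xy
    forward 1 _ = yz
    forward (suc (suc j)) (s≤s (s≤s ()))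
    corner : ∀ {u} → OneOf₃ x y z u → Σ ℕ λ k → k ≤ 2 × v k ≡ u
    corner (inj₁ refl)        = 0 , z≤n , refl
    corner (inj₂ (inj₁ refl)) = 1 , s≤s z≤n , refl
    corner (inj₂ (inj₂ refl)) = 2 , ≤-refl , refl

≤-offset : ∀ {a b} k → a + k ≡ b → a ≤ b
≤-offset {a} k refl = m≤m+n a k

1+m∸n≤1+[m∸n] : ∀ m n → suc m ∸ n ≤ suc (m ∸ n)
m∸n≤1+[m∸1+n] : ∀ m n → m ∸ n ≤ suc (m ∸ suc n)
1+m∸n≤1+[m∸n] m zero    = ≤-refl
1+m∸n≤1+[m∸n] m (suc n) = m∸n≤1+[m∸1+n] m n
m∸n≤1+[m∸1+n] zero    n       = ≤-trans (≤-reflexive (0∸n≡0 n)) z≤n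
m∸n≤1+[m∸1+n] (suc m) zero    = ≤-refl
m∸n≤1+[m∸1+n] (suc m) (suc n) = m∸n≤1+[m∸1+n] m n

m+n≤1+m : ∀ m {n} → n ≤ 1 → m + n ≤ suc m
m+n≤1+m m n≤1 = ≤-trans (+-monoʳ-≤ m n≤1) (≤-reflexive (+-comm m 1))

+-≤-suc : ∀ m {a b} → a ≤ suc b → m + a ≤ suc (m + b)
+-≤-suc m {b = b} a≤1+b = ≤-trans (+-monoʳ-≤ m a≤1+b) (≤-reflexive (+-suc m b))

m≤1+2[m/2] : ∀ m → m ≤ suc (2 * (m / 2))
m≤1+2[m/2] m = begin
  m                   ≡⟨ m≡m%n+[m/n]*n m 2 ⟩
  m % 2 + m / 2 * 2   ≤⟨ +-monoˡ-≤ (m / 2 * 2) (s≤s⁻¹ (m%n<n m 2)) ⟩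
  1 + m / 2 * 2       ≡⟨ cong suc (*-comm (m / 2) 2) ⟩
  suc (2 * (m / 2))   ∎
  where open ≤-Reasoning

2m≤1+2n⇒m≤n : ∀ {m n} → 2 * m ≤ suc (2 * n) → m ≤ n
2m≤1+2n⇒m≤n {m} {n} 2m≤1+2n = s≤s⁻¹ (*-cancelˡ-< 2 m (suc n) (begin-strict
  2 * m         ≤⟨ 2m≤1+2n ⟩
  suc (2 * n)   <⟨ ≤-refl ⟩
  2 + 2 * n     ≡⟨ sym (*-suc 2 n) ⟩
  2 * suc n     ∎))
  where open ≤-Reasoning

2n≤p+2d⇒n∸p/2≤d : ∀ p n d → 2 * n ≤ p + 2 * d → n ∸ p / 2 ≤ d
2n≤p+2d⇒n∸p/2≤d p n d 2n≤p+2d = m≤n+o⇒m∸n≤o n (p / 2) (2m≤1+2n⇒m≤n (begin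
  2 * n                        ≤⟨ 2n≤p+2d ⟩
  p + 2 * d                    ≤⟨ +-monoˡ-≤ (2 * d) (m≤1+2[m/2] p) ⟩
  suc (2 * (p / 2)) + 2 * d    ≡⟨ cong suc (sym (*-distribˡ-+ 2 (p / 2) d)) ⟩
  suc (2 * (p / 2 + d))        ∎))
  where open ≤-Reasoning

n/2≡⌊n/2⌋ : ∀ n → n / 2 ≡ ⌊ n /2⌋
n/2≡⌊n/2⌋ zero          = refl
n/2≡⌊n/2⌋ (suc zero)    = refl
n/2≡⌊n/2⌋ (suc (suc n)) = trans (m/n≡1+[m∸n]/n {2 + n} {2} (s≤s (s≤s z≤n))) (cong suc (n/2≡⌊n/2⌋ n))


bit : Bool → ℕ
bit true  = 1
bit false = 0

bit-not : ∀ b → bit b + bit (not b) ≡ 1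
bit-not true  = refl
bit-not false = refl

step-cost : Bool → ℕ
step-cost true  = 1
step-cost false = 2

step-cost≤2 : ∀ b → step-cost b ≤ 2
step-cost≤2 true  = s≤s z≤n
step-cost≤2 false = ≤-refl

step-cost-not : ∀ b → step-cost b + step-cost (not b) ≡ 3
step-cost-not true  = refl
step-cost-not false = refl

-- When every triangle is directed and the path edge a_i a_{i+1} points forward iff
-- dir i, this is the length of the shortest walk a₀ → a_j.
path-cost : (ℕ → Bool) → ℕ → ℕ
path-cost dir zero    = 0
path-cost dir (suc j) = step-cost (dir j) + path-cost dir j

path-cost-not : ∀ dir j → path-cost dir j + path-cost (not ∘ dir) j ≡ 3 * j
path-cost-not dir zero    = refl
path-cost-not dir (suc j) = begin
  (step-cost (dir j) + path-cost dir j) + (step-cost (not (dir j)) + path-cost (not ∘ dir) j)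
    ≡⟨ +-shuffle (step-cost (dir j)) (path-cost dir j) _ _ ⟩
  (step-cost (dir j) + step-cost (not (dir j))) + (path-cost dir j + path-cost (not ∘ dir) j)
    ≡⟨ cong₂ _+_ (step-cost-not (dir j)) (path-cost-not dir j) ⟩
  3 + 3 * j
    ≡⟨ sym (*-suc 3 j) ⟩
  3 * suc j ∎
  where
  open ≡-Reasoning
  +-shuffle : ∀ a b c d → (a + b) + (c + d) ≡ (a + c) + (b + d)
  +-shuffle = solve-∀

path-cost-≤-suc : ∀ dir j → path-cost dir j ≤ path-cost dir (suc j)
path-cost-≤-suc dir j = m≤n+m (path-cost dir j) (step-cost (dir j))

path-cost-suc-≤ : ∀ dir j → path-cost dir (suc j) ≤ 2 + path-cost dir j
path-cost-suc-≤ dir j = +-monoˡ-≤ (path-cost dir j) (step-cost≤2 (dir j))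


path-cost-mono : ∀ dir {i j} → i ≤′ j → path-cost dir i ≤ path-cost dir j
path-cost-mono dir ≤′-refl            = ≤-refl
path-cost-mono dir (≤′-step {j} i≤′j) = ≤-trans (path-cost-mono dir i≤′j) (path-cost-≤-suc dir j)

path-cost-period : ∀ dir → (∀ j → dir (suc j) ≡ not (dir j)) →
                   ∀ j → path-cost dir (suc (suc j)) ≡ 3 + path-cost dir j
path-cost-period dir alternates j rewrite alternates j = begin
  step-cost (not (dir j)) + (step-cost (dir j) + path-cost dir j)
    ≡⟨ sym (+-assoc (step-cost (not (dir j))) _ _) ⟩
  (step-cost (not (dir j)) + step-cost (dir j)) + path-cost dir j
    ≡⟨ cong (_+ path-cost dir j) (trans (+-comm (step-cost (not (dir j))) _) (step-cost-not (dir j))) ⟩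
  3 + path-cost dir j ∎
  where open ≡-Reasoning

alt : ℕ → Bool
alt zero    = true
alt (suc i) = not (alt i)

path-cost-alt : ∀ j → path-cost alt j ≡ j + ⌊ j /2⌋
path-cost-alt zero          = refl
path-cost-alt (suc zero)    = refl
path-cost-alt (suc (suc j)) = begin
  path-cost alt (2 + j)      ≡⟨ path-cost-period alt (λ _ → refl) j ⟩
  3 + path-cost alt j        ≡⟨ cong (3 +_) (path-cost-alt j) ⟩
  3 + (j + ⌊ j /2⌋)          ≡⟨ eq j ⌊ j /2⌋ ⟩
  2 + j + suc ⌊ j /2⌋        ∎
  where
  open ≡-Reasoning
  eq : ∀ j h → 3 + (j + h) ≡ 2 + j + suc h
  eq = solve-∀

path-cost-not-alt : ∀ j → path-cost (not ∘ alt) j + ⌊ j /2⌋ ≡ 2 * j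
path-cost-not-alt zero          = refl
path-cost-not-alt (suc zero)    = refl
path-cost-not-alt (suc (suc j)) = begin
  path-cost (not ∘ alt) (2 + j) + suc ⌊ j /2⌋
    ≡⟨ cong (_+ suc ⌊ j /2⌋) (path-cost-period (not ∘ alt) (λ _ → refl) j) ⟩
  3 + path-cost (not ∘ alt) j + suc ⌊ j /2⌋      ≡⟨ eq₁ (path-cost (not ∘ alt) j) ⌊ j /2⌋ ⟩
  4 + (path-cost (not ∘ alt) j + ⌊ j /2⌋)        ≡⟨ cong (4 +_) (path-cost-not-alt j) ⟩
  4 + 2 * j                                      ≡⟨ eq₂ j ⟩
  2 * (2 + j)                                    ∎
  where
  open ≡-Reasoning
  eq₁ : ∀ g h → 3 + g + suc h ≡ 4 + (g + h)
  eq₁ = solve-∀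
  eq₂ : ∀ j → 4 + 2 * j ≡ 2 * (2 + j)
  eq₂ = solve-∀

Adjacent : (ℕ → ℕ → Set) → ℕ → ℕ → Set
Adjacent E x y = E x y ⊎ E y x

adjacent-bounded : ∀ {n} {E : ℕ → ℕ → Set} → (∀ {x y} → E x y → x < n × y < n) →
                   ∀ {x y} → Adjacent E x y → x < n × y < n
adjacent-bounded E-bounded (inj₁ e) = E-bounded e
adjacent-bounded E-bounded (inj₂ e) = let (hy , hx) = E-bounded e in hx , hy

module LabelledOrientation {n : ℕ} (E : ℕ → ℕ → Set)
  (E-bounded : ∀ {x y} → E x y → x < n × y < n)
  (A : Digraph n)
  (A-orients : IsOrientation (λ u v → Adjacent E (toℕ u) (toℕ v)) A)
  (A-strong : Strong A) where

  infix 4 _⇢_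
  _⇢_ : ℕ → ℕ → Set
  x ⇢ y = ∃₂ λ w w′ → toℕ w ≡ x × toℕ w′ ≡ y × A w w′

  ⇢-asym : ∀ {x y} → x ⇢ y → y ⇢ x → ⊥
  ⇢-asym (w , w′ , refl , refl , a) (v , v′ , v≡w′ , v′≡w , b)
    with toℕ-injective v≡w′ | toℕ-injective v′≡w
  ... | refl | refl = proj₂ (proj₂ A-orients) w w′ a b

  ⇢⇒≢ : ∀ {x y} → x ⇢ y → x ≢ y
  ⇢⇒≢ x⇢x refl = ⇢-asym x⇢x x⇢x

  ⇢⇒adjacent : ∀ {x y} → x ⇢ y → Adjacent E x y
  ⇢⇒adjacent (w , w′ , refl , refl , a) = proj₁ A-orients w w′ a

  adjacent⇒⇢ : ∀ {x y} → Adjacent E x y → x ⇢ y ⊎ y ⇢ x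
  adjacent⇒⇢ xy =
    let (hx , hy) = adjacent-bounded E-bounded xy
    in ⊎-map (λ a → _ , _ , toℕ-fromℕ< hx , toℕ-fromℕ< hy , a)
             (λ a → _ , _ , toℕ-fromℕ< hy , toℕ-fromℕ< hx , a)
             (proj₁ (proj₂ A-orients) (fromℕ< hx) (fromℕ< hy)
               (subst₂ (Adjacent E) (sym (toℕ-fromℕ< hx)) (sym (toℕ-fromℕ< hy)) xy))

  out-arc : ∀ {x y} → x < n × y < n → x ≢ y → ∃ (x ⇢_)
  out-arc (hx , hy) x≢y
    with walk-head (proj₂ (A-strong (fromℕ< hx) (fromℕ< hy)))
                   (λ eq → x≢y (trans (sym (toℕ-fromℕ< hx)) (trans (cong toℕ eq) (toℕ-fromℕ< hy))))
  ... | w , a = toℕ w , _ , w , toℕ-fromℕ< hx , refl , a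

  pass-through : ∀ {x a b} → (∀ {y} → Adjacent E x y → y ≡ a ⊎ y ≡ b) →
                 Adjacent E x b → a ⇢ x → x ⇢ b
  pass-through neighbours xb a⇢x with adjacent⇒⇢ xb
  ... | inj₁ x⇢b = x⇢b
  ... | inj₂ b⇢x with out-arc (adjacent-bounded E-bounded xb) (≢-sym (⇢⇒≢ b⇢x))
  ...   | y , x⇢y with neighbours (⇢⇒adjacent x⇢y)
  ...     | inj₁ refl = ⊥-elim (⇢-asym a⇢x x⇢y)
  ...     | inj₂ refl = ⊥-elim (⇢-asym b⇢x x⇢y)

  Along : Bool → ℕ → ℕ → Set
  Along true  x y = x ⇢ y
  Along false x y = y ⇢ x

  along-choice : ∀ {x y} → Adjacent E x y → Σ Bool λ b → Along b x y
  along-choice xy with adjacent⇒⇢ xy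
  ... | inj₁ x⇢y = true , x⇢y
  ... | inj₂ y⇢x = false , y⇢x

  diameter-potential : ∀ {d} → DiamAtMost A d → (φ : ℕ → ℕ) →
                       (∀ {x y} → x ⇢ y → φ y ≤ suc (φ x)) →
                       ∀ {x y} (hx : x < n) (hy : y < n) → φ y ≤ φ x + d
  diameter-potential diam φ φ-step hx hy
    with diam (fromℕ< hx) (fromℕ< hy)
  ... | k , k≤d , ws =
    subst₂ (λ x y → φ y ≤ φ x + _) (toℕ-fromℕ< hx) (toℕ-fromℕ< hy)
      (≤-trans (walk-potential (λ w → φ (toℕ w)) (λ a → φ-step (_ , _ , refl , refl , a)) ws)
               (+-monoʳ-≤ _ k≤d))

-- The graph G_{n,p}

module GnpLayout (q r : ℕ) where

  p n : ℕ
  p = 2 + q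
  n = 5 + (2 * q + r)

  hub c-first c-last : ℕ
  hub     = p ∸ 1
  c-first = 2 * p ∸ 1
  c-last  = n ∸ 1

  b : ℕ → ℕ
  b i = p + i

  E : ℕ → ℕ → Set
  E = GEdge n p

  c-first≡ : c-first ≡ 3 + 2 * q
  c-first≡ = cong suc (trans (+-suc q _) (cong suc (+-suc q _)))

  c-last≡ : c-last ≡ suc r + c-first
  c-last≡ rewrite c-first≡ = eq q r
    where eq : ∀ q r → 4 + (2 * q + r) ≡ suc r + (3 + 2 * q)
          eq = solve-∀

  hub<p : hub < p
  hub<p = ≤-refl

  p<c-first : p < c-first
  p<c-first rewrite c-first≡ = ≤-offset q (eq q)
    where eq : ∀ q → 3 + q + q ≡ 3 + 2 * q
          eq = solve-∀

  c-first<c-last : c-first < c-last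
  c-first<c-last rewrite c-last≡ = m<n+m c-first z<s

  c-first≤c-last : c-first ≤ c-last
  c-first≤c-last = <⇒≤ c-first<c-last

  c-first<n : c-first < n
  c-first<n = <-trans c-first<c-last ≤-refl

  p<n : p < n
  p<n = <-trans p<c-first c-first<n

  b<c-first : ∀ {i} → suc i < p → b i < c-first
  b<c-first {i} (s≤s (s≤s i≤q)) rewrite c-first≡ =
    ≤-trans (s≤s (+-monoʳ-≤ p i≤q)) (≤-reflexive (eq q))
    where eq : ∀ q → suc (2 + q + q) ≡ 3 + 2 * q
          eq = solve-∀

  i<b : ∀ i → i < b i
  i<b i = m<n+m i {p} z<s

  1+i<b : ∀ i → suc i < b i
  1+i<b i = s≤s (s≤s (m≤n+m i q))

  <p⇒<c-first : ∀ {x} → x < p → x < c-first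
  <p⇒<c-first x<p = <-trans x<p p<c-first

  edge-bounded : ∀ {x y} → E x y → x < n × y < n
  edge-bounded (path i i+1<p)   = <-trans ≤-refl (<-trans i+1<p p<n) , <-trans i+1<p p<n
  edge-bounded (triL i i+1<p)   = <-trans (b<c-first i+1<p) c-first<n , <-trans ≤-refl (<-trans i+1<p p<n)
  edge-bounded (triR i i+1<p)   = <-trans (b<c-first i+1<p) c-first<n , <-trans i+1<p p<n
  edge-bounded (cyc x _ x+1<n)  = <-trans ≤-refl x+1<n , x+1<n
  edge-bounded close₁           = <-trans hub<p p<n , c-first<n
  edge-bounded close₂           = <-trans hub<p p<n , ≤-refl

  cycle-size : n ∸ c-first ≡ 2 + r
  cycle-size = trans (cong (λ x → suc x ∸ c-first) c-last≡) (m+n∸n≡m (2 + r) c-first)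

  cycle-vertex : ℕ → ℕ
  cycle-vertex zero    = hub
  cycle-vertex (suc m) = m + c-first

  suc-cycle<n : ∀ {m} → m ≤ r → suc (m + c-first) < n
  suc-cycle<n m≤r = s≤s (≤-trans (+-monoˡ-≤ c-first (s≤s m≤r)) (≤-reflexive (sym c-last≡)))

  cycle-neighbour : ∀ {x y} → c-first ≤ x → Adjacent E x y →
    (y ≡ suc x × suc x < n) ⊎ (suc y ≡ x × c-first ≤ y) ⊎ (y ≡ hub × (x ≡ c-first ⊎ x ≡ c-last))
  cycle-neighbour c≤x (inj₁ (path i i+1<p))  = ⊥-elim (<⇒≱ (<p⇒<c-first (<-trans ≤-refl i+1<p)) c≤x)
  cycle-neighbour c≤x (inj₁ (triL i i+1<p))  = ⊥-elim (<⇒≱ (b<c-first i+1<p) c≤x)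
  cycle-neighbour c≤x (inj₁ (triR i i+1<p))  = ⊥-elim (<⇒≱ (b<c-first i+1<p) c≤x)
  cycle-neighbour c≤x (inj₁ (cyc x _ x+1<n)) = inj₁ (refl , x+1<n)
  cycle-neighbour c≤x (inj₁ close₁)          = ⊥-elim (<⇒≱ (<p⇒<c-first hub<p) c≤x)
  cycle-neighbour c≤x (inj₁ close₂)          = ⊥-elim (<⇒≱ (<p⇒<c-first hub<p) c≤x)
  cycle-neighbour c≤x (inj₂ (path i i+1<p))  = ⊥-elim (<⇒≱ (<p⇒<c-first i+1<p) c≤x)
  cycle-neighbour c≤x (inj₂ (triL i i+1<p))  = ⊥-elim (<⇒≱ (<p⇒<c-first (<-trans ≤-refl i+1<p)) c≤x)
  cycle-neighbour c≤x (inj₂ (triR i i+1<p))  = ⊥-elim (<⇒≱ (<p⇒<c-first i+1<p) c≤x)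
  cycle-neighbour c≤x (inj₂ (cyc y c≤y _))   = inj₂ (inj₁ (refl , c≤y))
  cycle-neighbour c≤x (inj₂ close₁)          = inj₂ (inj₂ (refl , inj₁ refl))
  cycle-neighbour c≤x (inj₂ close₂)          = inj₂ (inj₂ (refl , inj₂ refl))

  inner-cycle-neighbour : ∀ m {y} → suc (m + c-first) < n → Adjacent E (cycle-vertex (suc m)) y →
                          y ≡ cycle-vertex m ⊎ y ≡ cycle-vertex (suc (suc m))
  inner-cycle-neighbour m x+1<n xy with cycle-neighbour (m≤n+m c-first m) xy
  ... | inj₁ (y≡x+1 , _) = inj₂ y≡x+1
  inner-cycle-neighbour zero    _ _ | inj₂ (inj₁ (refl , 1+y≤y)) = ⊥-elim (<-irrefl refl 1+y≤y)
  inner-cycle-neighbour (suc m) _ _ | inj₂ (inj₁ (y+1≡x , _))  = inj₁ (suc-injective y+1≡x)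
  inner-cycle-neighbour zero    _ _ | inj₂ (inj₂ (y≡hub , inj₁ _))   = inj₁ y≡hub
  inner-cycle-neighbour (suc m) _ _ | inj₂ (inj₂ (_ , inj₁ x≡c))     = ⊥-elim (m≢1+n+m c-first (sym x≡c))
  inner-cycle-neighbour m x+1<n _   | inj₂ (inj₂ (_ , inj₂ x≡c-last)) =
    ⊥-elim (<-irrefl refl (subst (λ x → suc x < n) x≡c-last x+1<n))

  c-last-neighbour : ∀ {y} → Adjacent E c-last y → y ≡ r + c-first ⊎ y ≡ hub
  c-last-neighbour xy with cycle-neighbour c-first≤c-last xy
  ... | inj₁ (_ , n<n)               = ⊥-elim (<-irrefl refl n<n)
  ... | inj₂ (inj₁ (y+1≡c-last , _)) = inj₁ (suc-injective (trans y+1≡c-last c-last≡))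
  ... | inj₂ (inj₂ (y≡hub , _))      = inj₂ y≡hub

-- Lower bound

module LowerBound (q r : ℕ) (A : Digraph (GnpLayout.n q r))
  (A-orients : IsOrientation (Gnp (GnpLayout.n q r) (GnpLayout.p q r)) A)
  (A-strong : Strong A) where

  open GnpLayout q r
  open LabelledOrientation E edge-bounded A A-orients A-strong

  cycle-directed : hub ⇢ c-first → ∀ m → m ≤ suc r → cycle-vertex m ⇢ cycle-vertex (suc m)
  cycle-directed hub⇢c zero    _         = hub⇢c
  cycle-directed hub⇢c (suc m) 1+m≤1+r =
    pass-through (inner-cycle-neighbour m x+1<n) (inj₁ (cyc (m + c-first) (m≤n+m c-first m) x+1<n))
                 (cycle-directed hub⇢c m (m≤n⇒m≤1+n (s≤s⁻¹ 1+m≤1+r)))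
    where x+1<n : suc (m + c-first) < n
          x+1<n = suc-cycle<n (s≤s⁻¹ 1+m≤1+r)

  cycle-closes : hub ⇢ c-first → c-last ⇢ hub
  cycle-closes hub⇢c =
    pass-through c-last-neighbour (inj₂ close₂)
      (subst (r + c-first ⇢_) (sym c-last≡) (cycle-directed hub⇢c (suc r) ≤-refl))

  cycle-offset : Bool → ℕ → ℕ
  cycle-offset true  x = suc x ∸ c-first
  cycle-offset false x = n ∸ x

  cycle-offset-suc : ∀ t x → cycle-offset t (suc x) ≤ suc (cycle-offset t x)
  cycle-offset-suc true  x = 1+m∸n≤1+[m∸n] (suc x) c-first
  cycle-offset-suc false x = ≤-trans (∸-monoʳ-≤ n (n≤1+n x)) (n≤1+n _)

  cycle-offset-pred : ∀ t x → cycle-offset t x ≤ suc (cycle-offset t (suc x))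
  cycle-offset-pred true  x = ≤-trans (∸-monoˡ-≤ c-first (n≤1+n (suc x))) (n≤1+n _)
  cycle-offset-pred false x = m∸n≤1+[m∸1+n] n x

  module Potential (dir : ℕ → Bool) (dir-sound : ∀ i → suc i < p → Along (dir i) i (suc i)) where

    H : ℕ → ℕ
    H = path-cost dir

    H-forward : ∀ i → suc i < p → i ⇢ suc i → H (suc i) ≡ suc (H i)
    H-forward i i+1<p i⇢i+1 with dir i | dir-sound i i+1<p
    ... | true  | _        = refl
    ... | false | i+1⇢i = ⊥-elim (⇢-asym i⇢i+1 i+1⇢i)

    apex-potential : Bool → ℕ → ℕ
    apex-potential true  zero    = 0
    apex-potential true  (suc i) = suc (H (suc i) + 1)
    apex-potential false i       = suc (H i + 0)

    apex≤1+left : ∀ t i → apex-potential t i ≤ suc (H i + bit t)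
    apex≤1+left true  zero    = z≤n
    apex≤1+left true  (suc i) = ≤-refl
    apex≤1+left false i       = ≤-refl

    left≤1+apex : ∀ t i → H i + bit t ≤ suc (apex-potential t i)
    left≤1+apex true  zero    = ≤-refl
    left≤1+apex true  (suc i) = m≤n+m _ 2
    left≤1+apex false i       = m≤n+m _ 2

    right≤1+apex : ∀ t → Along t 1 (b 0) → ∀ i → b i ⇢ suc i →
                   H (suc i) + bit t ≤ suc (apex-potential t i)
    right≤1+apex true  1⇢b₀ zero    b₀⇢1 = ⊥-elim (⇢-asym 1⇢b₀ b₀⇢1)
    right≤1+apex true  _    (suc i) _    = +-monoˡ-≤ 1 (path-cost-suc-≤ dir (suc i))
    right≤1+apex false _    i       _    = +-monoˡ-≤ 0 (path-cost-suc-≤ dir i)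

    c-first-offset : ∀ c → Along c hub c-first → hub ⇢ c-first → cycle-offset c c-first ≤ 1
    c-first-offset true  _     _     = ≤-reflexive (m+n∸n≡m 1 c-first)
    c-first-offset false c⇢hub hub⇢c = ⊥-elim (⇢-asym hub⇢c c⇢hub)

    c-last-offset : ∀ c → Along c hub c-first → hub ⇢ c-last → cycle-offset c c-last ≤ 1
    c-last-offset true  hub⇢c hub⇢c-last = ⊥-elim (⇢-asym (cycle-closes hub⇢c) hub⇢c-last)
    c-last-offset false _     _          = ≤-reflexive (m+n∸n≡m 1 (2 * q + r))

    -- t says whether the edge a₁ b₀ points to b₀, and then walks start at b₀ with
    -- potential 0; c says whether the cycle runs hub → c-first.
    φ : Bool → Bool → ℕ → ℕ
    φ t c x with x <? p
    ... | yes _ = H x + bit t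
    ... | no  _ with x <? c-first
    ...   | yes _ = apex-potential t (x ∸ p)
    ...   | no  _ = H hub + bit t + cycle-offset c x

    module _ (t c : Bool) where

      φ-path : ∀ {x} → x < p → φ t c x ≡ H x + bit t
      φ-path {x} x<p with x <? p
      ... | yes _   = refl
      ... | no  x≮p = ⊥-elim (x≮p x<p)

      φ-apex : ∀ {i} → suc i < p → φ t c (b i) ≡ apex-potential t i
      φ-apex {i} i+1<p with b i <? p
      ... | yes b<p = ⊥-elim (<⇒≱ b<p (m≤m+n p i))
      ... | no  _ with b i <? c-first
      ...   | yes _   = cong (apex-potential t) (m+n∸m≡n p i)
      ...   | no  b≮c = ⊥-elim (b≮c (b<c-first i+1<p))

      φ-cycle : ∀ {x} → c-first ≤ x → φ t c x ≡ H hub + bit t + cycle-offset c x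
      φ-cycle {x} c≤x with x <? p
      ... | yes x<p = ⊥-elim (<⇒≱ (<p⇒<c-first x<p) c≤x)
      ... | no  _ with x <? c-first
      ...   | yes x<c = ⊥-elim (<⇒≱ x<c c≤x)
      ...   | no  _   = refl

    module _ {t c : Bool} (apex-sound : Along t 1 (b 0)) (cycle-sound : Along c hub c-first) where

      private
        e : ℕ
        e = bit t

      φ-edge : ∀ {x y} → E x y →
               (x ⇢ y → φ t c y ≤ suc (φ t c x)) × (y ⇢ x → φ t c x ≤ suc (φ t c y))
      φ-edge (path i i+1<p) rewrite φ-path t c (<-trans ≤-refl i+1<p) | φ-path t c i+1<p =
        (λ i⇢i+1 → ≤-reflexive (cong (_+ e) (H-forward i i+1<p i⇢i+1))) ,
        (λ _ → ≤-trans (+-monoˡ-≤ e (path-cost-≤-suc dir i)) (n≤1+n _))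
      φ-edge (triL i i+1<p) rewrite φ-apex t c i+1<p | φ-path t c (<-trans ≤-refl i+1<p) =
        (λ _ → left≤1+apex t i) , (λ _ → apex≤1+left t i)
      φ-edge (triR i i+1<p) rewrite φ-apex t c i+1<p | φ-path t c i+1<p =
        right≤1+apex t apex-sound i ,
        (λ _ → ≤-trans (apex≤1+left t i) (s≤s (+-monoˡ-≤ e (path-cost-≤-suc dir i))))
      φ-edge (cyc x c≤x _) rewrite φ-cycle t c c≤x | φ-cycle t c (≤-trans c≤x (n≤1+n x)) =
        (λ _ → +-≤-suc (H hub + e) (cycle-offset-suc c x)) ,
        (λ _ → +-≤-suc (H hub + e) (cycle-offset-pred c x))
      φ-edge close₁ rewrite φ-path t c hub<p | φ-cycle t c (≤-refl {c-first}) =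
        (λ hub⇢c → m+n≤1+m (H hub + e) (c-first-offset c cycle-sound hub⇢c)) ,
        (λ _ → ≤-trans (m≤m+n _ _) (n≤1+n _))
      φ-edge close₂ rewrite φ-path t c hub<p | φ-cycle t c c-first≤c-last =
        (λ hub⇢c-last → m+n≤1+m (H hub + e) (c-last-offset c cycle-sound hub⇢c-last)) ,
        (λ _ → ≤-trans (m≤m+n _ _) (n≤1+n _))

      φ-step : ∀ {x y} → x ⇢ y → φ t c y ≤ suc (φ t c x)
      φ-step x⇢y with ⇢⇒adjacent x⇢y
      ... | inj₁ xy = proj₁ (φ-edge xy) x⇢y
      ... | inj₂ yx = proj₂ (φ-edge yx) x⇢y

    source : Bool → ℕ
    source true  = b 0
    source false = 0

    target : Bool → ℕ
    target true  = c-last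
    target false = c-first

    source<n : ∀ t → source t < n
    source<n true  = <-trans (b<c-first {0} (s≤s (s≤s z≤n))) c-first<n
    source<n false = z<s

    target<n : ∀ c → target c < n
    target<n true  = ≤-refl
    target<n false = c-first<n

    φ-source : ∀ t c → φ t c (source t) ≡ 0
    φ-source true  c = φ-apex true c (s≤s (s≤s z≤n))
    φ-source false c = φ-path false c z<s

    φ-target : ∀ t c → φ t c (target c) ≡ H hub + bit t + (n ∸ c-first)
    φ-target t true  = φ-cycle t true c-first≤c-last
    φ-target t false = φ-cycle t false ≤-refl

    half-bound : ∀ {t} → Along t 1 (b 0) → ∀ {d} → DiamAtMost A d →
                 path-cost dir hub + bit t + (n ∸ c-first) ≤ d
    half-bound {t} apex-sound diam with along-choice {hub} {c-first} (inj₁ close₁)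
    ... | c , cycle-sound =
      subst₂ (λ x y → x ≤ y + _) (φ-target t c) (φ-source t c)
        (diameter-potential diam (φ t c) (φ-step apex-sound cycle-sound) (source<n t) (target<n c))

module _ (q r : ℕ) (A : Digraph (GnpLayout.n q r))
  (A-orients : IsOrientation (Gnp (GnpLayout.n q r) (GnpLayout.p q r)) A)
  (A-strong : Strong A) where

  open GnpLayout q r

  private
    A⁻-orients : IsOrientation (Gnp n p) (flip A)
    A⁻-orients = flip-orientation swap A-orients

    A⁻-strong : Strong (flip A)
    A⁻-strong = flip-strong A-strong

    module O  = LabelledOrientation E edge-bounded A A-orients A-strong
    module O⁻ = LabelledOrientation E edge-bounded (flip A) A⁻-orients A⁻-strong
    module L  = LowerBound q r A A-orients A-strong
    module L⁻ = LowerBound q r (flip A) A⁻-orients A⁻-strong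

    dir : ℕ → Bool
    dir i with suc i <? p
    ... | yes i+1<p = proj₁ (O.along-choice (inj₁ (path i i+1<p)))
    ... | no  _     = true

    dir-sound : ∀ i → suc i < p → O.Along (dir i) i (suc i)
    dir-sound i i+1<p with suc i <? p
    ... | yes i+1<p′ = proj₂ (O.along-choice (inj₁ (path i i+1<p′)))
    ... | no  i+1≮p  = ⊥-elim (i+1≮p i+1<p)

    along-flip : ∀ t {x y} → O.Along t x y → O⁻.Along (not t) x y
    along-flip true  (w , w′ , w≡x , w′≡y , a) = w′ , w , w′≡y , w≡x , a
    along-flip false (w , w′ , w≡y , w′≡x , a) = w′ , w , w′≡x , w≡y , a

    apex : Σ Bool λ t → O.Along t 1 (b 0)
    apex = O.along-choice (inj₂ (triR 0 (s≤s (s≤s z≤n))))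

    t : Bool
    t = proj₁ apex

  lower-bound : ∀ {d} → DiamAtMost A d → n ∸ p / 2 ≤ d
  lower-bound {d} diam = 2n≤p+2d⇒n∸p/2≤d p n d (begin
    2 * n
      ≡⟨ doubling q r ⟩
    p + (3 * hub + 1 + 2 * (2 + r))
      ≡⟨ cong (p +_) (sym (cong₃ (λ h e m → h + e + 2 * m) (path-cost-not dir hub) (bit-not t) cycle-size)) ⟩
    p + ((path-cost dir hub + path-cost (not ∘ dir) hub) + (bit t + bit (not t)) + 2 * (n ∸ c-first))
      ≡⟨ cong (p +_) (interchange (path-cost dir hub) _ (bit t) _ (n ∸ c-first)) ⟩
    p + ((path-cost dir hub + bit t + (n ∸ c-first)) + (path-cost (not ∘ dir) hub + bit (not t) + (n ∸ c-first)))
      ≤⟨ +-monoʳ-≤ p (+-mono-≤ half half⁻) ⟩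
    p + (d + d)
      ≡⟨ cong (p +_) (sym (2*m≡m+m d)) ⟩
    p + 2 * d ∎)
    where
    open ≤-Reasoning
    half : path-cost dir hub + bit t + (n ∸ c-first) ≤ d
    half = L.Potential.half-bound dir dir-sound (proj₂ apex) diam
    half⁻ : path-cost (not ∘ dir) hub + bit (not t) + (n ∸ c-first) ≤ d
    half⁻ = L⁻.Potential.half-bound (not ∘ dir) (λ i i+1<p → along-flip (dir i) (dir-sound i i+1<p))
                                     (along-flip t (proj₂ apex)) (flip-diameter diam)
    doubling : ∀ q r → 2 * (5 + (2 * q + r)) ≡ (2 + q) + (3 * suc q + 1 + 2 * (2 + r))
    doubling = solve-∀
    interchange : ∀ a b x y m → (a + b) + (x + y) + 2 * m ≡ (a + x + m) + (b + y + m)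
    interchange = solve-∀
    2*m≡m+m : ∀ m → 2 * m ≡ m + m
    2*m≡m+m = solve-∀
    cong₃ : ∀ (f : ℕ → ℕ → ℕ → ℕ) {a a′ b b′ c c′} → a ≡ a′ → b ≡ b′ → c ≡ c′ → f a b c ≡ f a′ b′ c′
    cong₃ f refl refl refl = refl

-- Upper bound

module UpperBound (q r : ℕ) where

  open GnpLayout q r

  -- The edge {x, y} with x < y is directed x → y iff ascends x y: path edges alternate,
  -- every triangle is a directed triangle, and the cycle runs hub → c-first → ⋯ → c-last → hub.
  ascends : ℕ → ℕ → Bool
  ascends x y with y <? p
  ... | yes _ = alt x
  ... | no  _ with y <? c-first
  ...   | yes _ = not (alt x)
  ...   | no  _ with x ≟ hub | y ≟ c-last
  ...     | yes _ | yes _ = false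
  ...     | _     | _     = true

  ascends-path : ∀ {x y} → y < p → ascends x y ≡ alt x
  ascends-path {x} {y} y<p with y <? p
  ... | yes _   = refl
  ... | no  y≮p = ⊥-elim (y≮p y<p)

  ascends-apex : ∀ {x i} → suc i < p → ascends x (b i) ≡ not (alt x)
  ascends-apex {x} {i} i+1<p with b i <? p
  ... | yes b<p = ⊥-elim (<⇒≱ b<p (m≤m+n p i))
  ... | no  _ with b i <? c-first
  ...   | yes _   = refl
  ...   | no  b≮c = ⊥-elim (b≮c (b<c-first i+1<p))

  ascends-cycle : ∀ {x y} → c-first ≤ y → ¬ (x ≡ hub × y ≡ c-last) → ascends x y ≡ true
  ascends-cycle {x} {y} c≤y not-closing with y <? p
  ... | yes y<p = ⊥-elim (<⇒≱ (<p⇒<c-first y<p) c≤y)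
  ... | no  _ with y <? c-first
  ...   | yes y<c = ⊥-elim (<⇒≱ y<c c≤y)
  ...   | no  _ with x ≟ hub | y ≟ c-last
  ...     | yes x≡hub | yes y≡c-last = ⊥-elim (not-closing (x≡hub , y≡c-last))
  ...     | yes _     | no  _        = refl
  ...     | no  _     | _            = refl

  ascends-closing : ascends hub c-last ≡ false
  ascends-closing with c-last <? p
  ... | yes c<p = ⊥-elim (<⇒≱ (<p⇒<c-first c<p) c-first≤c-last)
  ... | no  _ with c-last <? c-first
  ...   | yes c<c = ⊥-elim (<⇒≱ c<c c-first≤c-last)
  ...   | no  _ with hub ≟ hub | c-last ≟ c-last
  ...     | yes _ | yes _   = refl
  ...     | no  ≢ | _       = ⊥-elim (≢ refl)
  ...     | yes _ | no  ≢   = ⊥-elim (≢ refl)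

  Arc : ℕ → ℕ → Set
  Arc x y = Adjacent E x y × ((x < y × ascends x y ≡ true) ⊎ (y < x × ascends y x ≡ false))

  A : Digraph n
  A u v = Arc (toℕ u) (toℕ v)

  edge-irreflexive : ∀ {x y} → E x y → x ≢ y
  edge-irreflexive (path i _)  = ≢-sym 1+n≢n
  edge-irreflexive (triL i _)  = ≢-sym (<⇒≢ (i<b i))
  edge-irreflexive (triR i _)  = ≢-sym (<⇒≢ (1+i<b i))
  edge-irreflexive (cyc x _ _) = ≢-sym 1+n≢n
  edge-irreflexive close₁      = <⇒≢ (<-trans hub<p p<c-first)
  edge-irreflexive close₂      = <⇒≢ (<-trans hub<p (<-trans p<c-first c-first<c-last))

  A-orients : IsOrientation (Gnp n p) A
  A-orients = (λ _ _ → proj₁) , total , asym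
    where
    total : ∀ u v → Gnp n p u v → A u v ⊎ A v u
    total u v uv with <-cmp (toℕ u) (toℕ v)
    ... | tri≈ _ u≡v _ =
      ⊥-elim ([ (λ e → edge-irreflexive e u≡v) , (λ e → edge-irreflexive e (sym u≡v)) ]′ uv)
    ... | tri< u<v _ _ with ascends (toℕ u) (toℕ v)
    ...   | true  = inj₁ (uv , inj₁ (u<v , refl))
    ...   | false = inj₂ (swap uv , inj₂ (u<v , refl))
    total u v uv | tri> _ _ v<u with ascends (toℕ v) (toℕ u)
    ...   | true  = inj₂ (swap uv , inj₁ (v<u , refl))
    ...   | false = inj₁ (uv , inj₂ (v<u , refl))
    asym : ∀ u v → A u v → A v u → ⊥
    asym _ _ (_ , inj₁ (u<v , _))  (_ , inj₁ (v<u , _))  = <-asym u<v v<u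
    asym _ _ (_ , inj₁ (_ , up))   (_ , inj₂ (_ , down)) with () ← trans (sym up) down
    asym _ _ (_ , inj₂ (_ , down)) (_ , inj₁ (_ , up))   with () ← trans (sym up) down
    asym _ _ (_ , inj₂ (v<u , _))  (_ , inj₂ (u<v , _))  = <-asym u<v v<u

  arc-bounded : ∀ {x y} → Arc x y → y < n
  arc-bounded (xy , _) = proj₂ (adjacent-bounded edge-bounded xy)

  data TriangleArcs (i : ℕ) : Bool → Set where
    forward  : Arc i (suc i) → Arc (suc i) (b i) → Arc (b i) i → TriangleArcs i true
    backward : Arc (suc i) i → Arc i (b i) → Arc (b i) (suc i) → TriangleArcs i false

  triangle-arcs : ∀ {i} → suc i < p → TriangleArcs i (alt i)
  triangle-arcs {i} i+1<p with alt i in dir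
  ... | true  = forward  (inj₁ (path i i+1<p) , inj₁ (≤-refl , trans (ascends-path i+1<p) dir))
                         (inj₂ (triR i i+1<p) , inj₁ (1+i<b i , trans (ascends-apex i+1<p) (cong (not ∘ not) dir)))
                         (inj₁ (triL i i+1<p) , inj₂ (i<b i , trans (ascends-apex i+1<p) (cong not dir)))
  ... | false = backward (inj₂ (path i i+1<p) , inj₂ (≤-refl , trans (ascends-path i+1<p) dir))
                         (inj₂ (triL i i+1<p) , inj₁ (i<b i , trans (ascends-apex i+1<p) (cong not dir)))
                         (inj₁ (triR i i+1<p) , inj₂ (1+i<b i , trans (ascends-apex i+1<p) (cong (not ∘ not) dir)))

  F G : ℕ → ℕ
  F = path-cost alt
  G = path-cost (not ∘ alt)

  forward-step : ∀ {j} → suc j < p → Chain Arc j (suc j) (step-cost (alt j))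
  forward-step {j} j+1<p with alt j | triangle-arcs j+1<p
  ... | true  | forward a _ _   = a ∷ []
  ... | false | backward _ a a′ = a ∷ a′ ∷ []

  backward-step : ∀ {j} → suc j < p → Chain Arc (suc j) j (step-cost (not (alt j)))
  backward-step {j} j+1<p with alt j | triangle-arcs j+1<p
  ... | true  | forward _ a a′ = a ∷ a′ ∷ []
  ... | false | backward a _ _ = a ∷ []

  ascending : ∀ {i j} → i ≤′ j → j < p → Σ ℕ λ k → Chain Arc i j k × k + F i ≡ F j
  ascending ≤′-refl _ = 0 , [] , refl
  ascending {i} (≤′-step {j} i≤′j) j+1<p with ascending i≤′j (<-trans ≤-refl j+1<p)
  ... | k , xs , k+Fi≡Fj =
    k + step-cost (alt j) , xs ++ forward-step j+1<p ,
    trans (shuffle k (step-cost (alt j)) (F i)) (cong (step-cost (alt j) +_) k+Fi≡Fj)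
    where shuffle : ∀ k s f → k + s + f ≡ s + (k + f)
          shuffle = solve-∀

  descending : ∀ {i j} → i ≤′ j → j < p → Σ ℕ λ k → Chain Arc j i k × k + G i ≡ G j
  descending ≤′-refl _ = 0 , [] , refl
  descending {i} (≤′-step {j} i≤′j) j+1<p with descending i≤′j (<-trans ≤-refl j+1<p)
  ... | k , xs , k+Gi≡Gj =
    step-cost (not (alt j)) + k , backward-step j+1<p ++ xs ,
    trans (+-assoc (step-cost (not (alt j))) k (G i)) (cong (step-cost (not (alt j)) +_) k+Gi≡Gj)

  Corner : ℕ → ℕ → Set
  Corner i = OneOf₃ i (suc i) (b i)

  triangle-within : ∀ {i x y} → suc i < p → Corner i x → Corner i y → Within Arc x y 2
  triangle-within {i} i+1<p with alt i | triangle-arcs i+1<p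
  ... | true  | forward a a′ a″  = directed-triangle-within a a′ a″
  ... | false | backward a a′ a″ = λ x∈ y∈ → directed-triangle-within a a′ a″ (swap₁₂ x∈) (swap₁₂ y∈)
    where
    swap₁₂ : ∀ {x} → Corner i x → OneOf₃ (suc i) i (b i) x
    swap₁₂ (inj₁ x≡i)          = inj₂ (inj₁ x≡i)
    swap₁₂ (inj₂ (inj₁ x≡i+1)) = inj₁ x≡i+1
    swap₁₂ (inj₂ (inj₂ x≡b))   = inj₂ (inj₂ x≡b)

  cycle-arc : ∀ j → j < suc (suc r) → Arc (cycle-vertex j) (cycle-vertex (suc j))
  cycle-arc zero    _ =
    inj₁ close₁ , inj₁ (<-trans hub<p p<c-first ,
                        ascends-cycle ≤-refl (λ (_ , c-first≡c-last) → <⇒≢ c-first<c-last c-first≡c-last))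
  cycle-arc (suc m) 1+m<2+r =
    inj₁ (cyc (m + c-first) c≤x (suc-cycle<n (s≤s⁻¹ (s≤s⁻¹ 1+m<2+r)))) ,
    inj₁ (≤-refl , ascends-cycle (≤-trans c≤x (n≤1+n _))
                     (λ (x≡hub , _) → <⇒≱ (<-trans hub<p p<c-first) (≤-trans c≤x (≤-reflexive x≡hub))))
    where c≤x : c-first ≤ m + c-first
          c≤x = m≤n+m c-first m

  closing-arc : Arc (cycle-vertex (suc (suc r))) hub
  closing-arc = subst (λ x → Arc x hub) c-last≡
    (inj₂ close₂ , inj₂ (<-trans hub<p (<-trans p<c-first c-first<c-last) , ascends-closing))

  cycle-within : ∀ {i j} → i ≤ suc (suc r) → j ≤ suc (suc r) →
                 Within Arc (cycle-vertex i) (cycle-vertex j) (2 + r)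
  cycle-within = DirectedCycle.within cycle-vertex (suc (suc r)) cycle-arc closing-arc

  D : ℕ
  D = n ∸ p / 2

  ≤D : ∀ {x} → x + suc ⌊ q /2⌋ ≤ n → x ≤ D
  ≤D {x} x+h≤n = subst (λ h → x ≤ n ∸ h) (sym (n/2≡⌊n/2⌋ p)) (m+n≤o⇒m≤o∸n x x+h≤n)

  via-hub-to-cycle : 1 + F hub + (2 + r) ≤ D
  via-hub-to-cycle = ≤D (≤-reflexive (begin
    1 + F hub + (2 + r) + suc ⌊ q /2⌋          ≡⟨ cong (λ f → 1 + f + (2 + r) + suc ⌊ q /2⌋) (path-cost-alt (suc q)) ⟩
    1 + (suc q + ⌈ q /2⌉) + (2 + r) + suc ⌊ q /2⌋ ≡⟨ eq₁ q r ⌈ q /2⌉ ⌊ q /2⌋ ⟩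
    5 + (q + (⌊ q /2⌋ + ⌈ q /2⌉) + r)          ≡⟨ cong (λ h → 5 + (q + h + r)) (⌊n/2⌋+⌈n/2⌉≡n q) ⟩
    5 + (q + q + r)                            ≡⟨ eq₂ q r ⟩
    n                                          ∎))
    where
    open ≡-Reasoning
    eq₁ : ∀ q r c h → 1 + (suc q + c) + (2 + r) + suc h ≡ 5 + (q + (h + c) + r)
    eq₁ = solve-∀
    eq₂ : ∀ q r → 5 + (q + q + r) ≡ 5 + (2 * q + r)
    eq₂ = solve-∀

  via-hub-from-cycle : 2 + r + G hub ≤ D
  via-hub-from-cycle = ≤D (begin
    2 + r + G hub + suc ⌊ q /2⌋    ≤⟨ +-monoʳ-≤ (2 + r + G hub) (s≤s (⌊n/2⌋≤⌈n/2⌉ q)) ⟩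
    2 + r + G hub + suc ⌈ q /2⌉    ≡⟨ eq₁ r (G hub) ⌈ q /2⌉ ⟩
    3 + r + (G hub + ⌈ q /2⌉)      ≡⟨ cong (λ g → 3 + r + g) (path-cost-not-alt (suc q)) ⟩
    3 + r + 2 * suc q              ≡⟨ eq₂ q r ⟩
    n                              ∎)
    where
    open ≤-Reasoning
    eq₁ : ∀ r g c → 2 + r + g + suc c ≡ 3 + r + (g + c)
    eq₁ = solve-∀
    eq₂ : ∀ q r → 3 + r + 2 * suc q ≡ 5 + (2 * q + r)
    eq₂ = solve-∀

  2+r≤D : 2 + r ≤ D
  2+r≤D = ≤-trans (m≤m+n (2 + r) (G hub)) via-hub-from-cycle

  1≤F[1+i] : ∀ i → 1 ≤ F (suc i)
  1≤F[1+i] i = path-cost-mono alt {1} {suc i} (≤⇒≤′ (s≤s z≤n))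

  2≤G[1+i] : ∀ i → 2 ≤ G (suc i)
  2≤G[1+i] i = path-cost-mono (not ∘ alt) {1} {suc i} (≤⇒≤′ (s≤s z≤n))

  to-hub : ∀ {i x} → suc i < p → Corner i x → Within Arc x hub (1 + F hub)
  to-hub {i} i+1<p x∈ with ascending (≤⇒≤′ (s≤s⁻¹ i+1<p)) hub<p
  ... | k , ys , k+F≡F = within-weaken bound (triangle-within i+1<p x∈ (inj₂ (inj₁ refl)) ⊕ (k , ≤-refl , ys))
    where
    open ≤-Reasoning
    bound : 2 + k ≤ 1 + F hub
    bound = begin
      2 + k               ≡⟨ cong suc (+-comm 1 k) ⟩
      1 + (k + 1)         ≤⟨ +-monoʳ-≤ 1 (+-monoʳ-≤ k (1≤F[1+i] i)) ⟩
      1 + (k + F (suc i)) ≡⟨ cong suc k+F≡F ⟩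
      1 + F hub           ∎

  from-hub : ∀ {j y} → suc j < p → Corner j y → Within Arc hub y (G hub)
  from-hub {j} j+1<p y∈ with descending (≤⇒≤′ (s≤s⁻¹ j+1<p)) hub<p
  ... | k , ys , k+G≡G = within-weaken bound ((k , ≤-refl , ys) ⊕ triangle-within j+1<p (inj₂ (inj₁ refl)) y∈)
    where
    bound : k + 2 ≤ G hub
    bound = ≤-trans (+-monoʳ-≤ k (2≤G[1+i] j)) (≤-reflexive k+G≡G)

  data Position : ℕ → Set where
    triangle : ∀ {x} i → suc i < p → Corner i x → Position x
    cycle    : ∀ j → j ≤ suc (suc r) → Position (cycle-vertex j)

  position : ∀ x → x < n → Position x
  position x x<n with x <? hub
  ... | yes x<hub = triangle x (s≤s x<hub) (inj₁ refl)
  ... | no  x≮hub with x <? p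
  ...   | yes x<p = subst Position (≤-antisym (≮⇒≥ x≮hub) (s≤s⁻¹ x<p)) (cycle 0 z≤n)
  ...   | no  x≮p with x <? c-first
  ...     | yes x<c = triangle (x ∸ p) (s≤s (s≤s (m≤n+o⇒m∸n≤o x p x≤p+q)))
                               (inj₂ (inj₂ (sym (m+[n∸m]≡n (≮⇒≥ x≮p)))))
    where
    x≤p+q : x ≤ p + q
    x≤p+q = s≤s⁻¹ (≤-trans x<c (≤-reflexive (trans c-first≡ (eq q))))
      where eq : ∀ q → 3 + 2 * q ≡ suc (2 + q + q)
            eq = solve-∀
  ...     | no  x≮c = subst Position (m∸n+n≡m (≮⇒≥ x≮c))
                        (cycle (suc (x ∸ c-first)) (s≤s (m≤n+o⇒m∸n≤o x c-first x≤c+1+r)))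
    where
    x≤c+1+r : x ≤ c-first + suc r
    x≤c+1+r = ≤-trans (s≤s⁻¹ x<n) (≤-reflexive (trans c-last≡ (+-comm (suc r) c-first)))

  within-D : ∀ {x y} → Position x → Position y → Within Arc x y D
  within-D (triangle i i+1<p x∈) (triangle j j+1<p y∈) with <-cmp i j
  ... | tri≈ _ refl _ = within-weaken (≤-trans (m≤m+n 2 r) 2+r≤D) (triangle-within i+1<p x∈ y∈)
  ... | tri< i<j _ _ with ascending (≤⇒≤′ i<j) (<-trans ≤-refl j+1<p)
  ...   | k , ys , k+F≡F = within-weaken bound
          (triangle-within i+1<p x∈ (inj₂ (inj₁ refl)) ⊕ (k , ≤-refl , ys) ⊕
           triangle-within j+1<p (inj₁ refl) y∈)
    where
    open ≤-Reasoning
    bound : 2 + (k + 2) ≤ D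
    bound = begin
      2 + (k + 2)          ≡⟨ eq k ⟩
      3 + (k + 1)          ≤⟨ +-monoʳ-≤ 3 (+-monoʳ-≤ k (1≤F[1+i] i)) ⟩
      3 + (k + F (suc i))  ≡⟨ cong (3 +_) k+F≡F ⟩
      3 + F j              ≤⟨ +-monoʳ-≤ 3 (path-cost-mono alt (≤⇒≤′ (s≤s⁻¹ (<-trans ≤-refl j+1<p)))) ⟩
      3 + F hub            ≡⟨ +-comm 3 (F hub) ⟩
      F hub + 3            ≤⟨ +-monoʳ-≤ (F hub) (m≤m+n 3 r) ⟩
      F hub + (3 + r)      ≡⟨ +-suc (F hub) (2 + r) ⟩
      1 + F hub + (2 + r)  ≤⟨ via-hub-to-cycle ⟩
      D                    ∎
      where eq : ∀ k → 2 + (k + 2) ≡ 3 + (k + 1)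
            eq = solve-∀
  within-D (triangle i i+1<p x∈) (triangle j j+1<p y∈) | tri> _ _ j<i
    with descending (≤⇒≤′ j<i) (<-trans ≤-refl i+1<p)
  ... | k , ys , k+G≡G = within-weaken bound
          (triangle-within i+1<p x∈ (inj₁ refl) ⊕ (k , ≤-refl , ys) ⊕
           triangle-within j+1<p (inj₂ (inj₁ refl)) y∈)
    where
    open ≤-Reasoning
    bound : 2 + (k + 2) ≤ D
    bound = begin
      2 + (k + 2)          ≤⟨ +-monoʳ-≤ 2 (+-monoʳ-≤ k (2≤G[1+i] j)) ⟩
      2 + (k + G (suc j))  ≡⟨ cong (2 +_) k+G≡G ⟩
      2 + G i              ≤⟨ +-monoʳ-≤ 2 (path-cost-mono (not ∘ alt) (≤⇒≤′ (<⇒≤ (s≤s⁻¹ i+1<p)))) ⟩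
      2 + G hub            ≤⟨ +-monoˡ-≤ (G hub) (m≤m+n 2 r) ⟩
      2 + r + G hub        ≤⟨ via-hub-from-cycle ⟩
      D                    ∎
  within-D (triangle i i+1<p x∈) (cycle j j≤) =
    within-weaken via-hub-to-cycle (to-hub i+1<p x∈ ⊕ cycle-within z≤n j≤)
  within-D (cycle i i≤) (triangle j j+1<p y∈) =
    within-weaken via-hub-from-cycle (cycle-within i≤ z≤n ⊕ from-hub j+1<p y∈)
  within-D (cycle i i≤) (cycle j j≤) =
    within-weaken 2+r≤D (cycle-within i≤ j≤)

  diameter : DiamAtMost A D
  diameter u v with within-D (position (toℕ u) (toℕ<n u)) (position (toℕ v) (toℕ<n v))
  ... | k , k≤D , xs = k , k≤D , chain⇒walk arc-bounded xs u v refl refl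

oriented-diameter : ∀ q r → let open GnpLayout q r in OrientedDiameter (Gnp n p) (n ∸ p / 2)
oriented-diameter q r =
  (A , A-orients , diameter⇒strong diameter , diameter) ,
  λ A′ d A′-orients A′-strong diam → lower-bound q r A′ A′-orients A′-strong diam
  where open UpperBound q r

proposition3 : (n p : ℕ) → 2 ≤ p → 2 * p + 1 ≤ n →
    OrientedDiameter (Gnp n p) (n ∸ p / 2)
proposition3 n p 2≤p 2p+1≤n with m≤n⇒∃[o]m+o≡n 2≤p | m≤n⇒∃[o]m+o≡n 2p+1≤n
... | q , refl | r , refl =
  subst (λ m → OrientedDiameter (Gnp m (2 + q)) (m ∸ (2 + q) / 2)) (size q r) (oriented-diameter q r)
  where
  size : ∀ q r → 5 + (2 * q + r) ≡ 2 * (2 + q) + 1 + r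
  size = solve-∀
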